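{- For every $b\in\widehat F(s)$, one has $\widehat\xi(b)^\star=\mathrm{pr}(b^\star)$.
   Context: Fix integers $n,\ell\ge2$ and $s\in\mathbb Z$. A semi-infinite column is a subset $c\subseteq\mathbb Z$ of the form $\{x_1,\dots,x_k\}\sqcup\{x\in\mathbb Z: x<x_1\}$ with $x_1<\cdots<x_k$; set $s(c)=x_1+k-1$ for such a representation with $x_1$ minimal such that $x_1+1\notin c$ (standard form). $\widehat F(s)$ is the set of $b=c_\ell\otimes\cdots\otimes c_1$ of semi-infinite columns with $\sum_j s(c_j)=s$; $\dot{\widehat F}(s)$ is the set of $d_1\otimes\cdots\otimes d_n$ of semi-infinite columns with $\sum_i s(d_i)=s$. Duality $\star$ (Uglov): for $b=c_\ell\otimes\cdots\otimes c_1$, $b^\star=d_1\otimes\cdots\otimes d_n$ with $d_i=\{(k-1)\ell+j:\ k\in\mathbb Z,\ 1\le j\le\ell,\ (k-1)n+i\in c_j\}$ (equivalently: encode $b$ by the $\mathbb Z\times\ell$ binary matrix $M_{r,j}=[r\in c_j]$, cut it into consecutive $n\times\ell$ blocks of rows $(k-1)n+1,\dots,kn$, transpose each block and stack the results, and read columns of the resulting $\mathbb Z\times n$ matrix). For a semi-infinite column $c$ let $c^+=\{x+n:x\in c\}$. Affine cyclage: $\widehat\xi(c_\ell\otimes c_{\ell-1}\otimes\cdots\otimes c_1)=c_{\ell-1}\otimes\cdots\otimes c_1\otimes c_\ell^+\in\widehat F(s+n)$. Promotion: $\mathrm{pr}(d_1\otimes\cdots\otimes d_n)=\mathrm{pr}(d_1)\otimes\cdots\otimes\mathrm{pr}(d_n)\in\dot{\widehat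 F}(s+n)$ with $\mathrm{pr}(d)=\{k+1:k\in d\}$; the duality $\star$ is applied on $\widehat F(s+n)$ on the left-hand side. -}

module Defs where

open import Data.Nat using (ℕ; zero; suc)
open import Data.Integer using (ℤ; +_; _+_; _-_; _*_; _<_)
open import Data.Fin using (Fin; zero; suc; toℕ; fromℕ; inject₁)
open import Data.List using (List; []; _∷_; length)
open import Data.List.Membership.Propositional using (_∈_)
open import Data.List.Relation.Unary.Linked using (Linked)
open import Data.Product using (Σ; _×_; _,_)
open import Data.Sum using (_⊎_)
open import Function.Bundles using (_⇔_)
open import Relation.Binary.PropositionalEquality using (_≡_)

Col : Set₁
Col = ℤ → Set

-- c is a semi-infinite column, represented as {x₁,…,x_k} ⊔ {x < x₁} with
-- x₁ < ⋯ < x_k (here the list x₁ ∷ xs, so k = 1 + length xs), and its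
-- charge s(c) = x₁ + k - 1 = x₁ + length xs equals t.
-- (The value x₁ + k - 1 does not depend on the chosen representation.)
HasCharge : Col → ℤ → Set
HasCharge c t =
  Σ ℤ λ x₁ → Σ (List ℤ) λ xs →
    Linked _<_ (x₁ ∷ xs) ×
    ((x : ℤ) → c x ⇔ (x ∈ (x₁ ∷ xs) ⊎ x < x₁)) ×
    (t ≡ x₁ + + length xs)

sumℤ : {m : ℕ} → (Fin m → ℤ) → ℤ
sumℤ {zero}  f = + 0
sumℤ {suc m} f = f zero + sumℤ (λ j → f (suc j))

-- b = c_ℓ ⊗ ⋯ ⊗ c_1 is encoded as b : Fin ℓ → Col with b j = c_{toℕ j + 1}.
-- b ∈ F̂(s): every c_j is a semi-infinite column and Σ_j s(c_j) = s.
InFhat : (ℓ : ℕ) → ℤ → (Fin ℓ → Col) → Set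
InFhat ℓ s b =
  Σ (Fin ℓ → ℤ) λ ch → ((j : Fin ℓ) → HasCharge (b j) (ch j)) × (sumℤ ch ≡ s)

shiftCol : ℕ → Col → Col
shiftCol n c x = c (x - + n)

-- Affine cyclage: c_ℓ ⊗ c_{ℓ-1} ⊗ ⋯ ⊗ c_1 ↦ c_{ℓ-1} ⊗ ⋯ ⊗ c_1 ⊗ c_ℓ⁺,
-- i.e. new c'_1 = c_ℓ⁺ and c'_j = c_{j-1} for j ≥ 2.
xiHat : (n : ℕ) {ℓ : ℕ} → (Fin ℓ → Col) → Fin ℓ → Col
xiHat n {suc m} b zero    = shiftCol n (b (fromℕ m))
xiHat n {suc m} b (suc j) = b (inject₁ j)

-- Uglov duality: b⋆ = d_1 ⊗ ⋯ ⊗ d_n encoded as Fin n → Col with index i ↦ d_{toℕ i + 1},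
-- d_i = {(k-1)ℓ + j : k ∈ ℤ, 1 ≤ j ≤ ℓ, (k-1)n + i ∈ c_j}.
star : (n ℓ : ℕ) → (Fin ℓ → Col) → Fin n → Col
star n ℓ b i y =
  Σ ℤ λ k → Σ (Fin ℓ) λ j →
    (y ≡ (k - + 1) * + ℓ + + (suc (toℕ j))) ×
    b j ((k - + 1) * + n + + (suc (toℕ i)))

prCol : Col → Col
prCol d y = d (y - + 1)

pr : {n : ℕ} → (Fin n → Col) → Fin n → Col
pr d i = prCol (d i)

{-# OPTIONS --safe #-}
-- Number the cells of the ℓ-column encoding row-major, block k and column j
-- getting slot ℓ k j = (k - 1) ℓ + j.  Cyclage moves column j to
-- column j + 1 within the same block, and moves column ℓ of block k to column 1
-- of block k + 1 (the shift by n in c_ℓ⁺ is exactly one block of rows), so in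
-- both cases every slot goes up by one: this is the promotion of b⋆.
module Submission where

open import Defs
open import Data.Nat using (ℕ; _≤_; suc; s≤s)
open import Data.Integer using (ℤ; +_; _+_; _-_; _*_)
open import Data.Integer.Tactic.RingSolver using (solve-∀)
open import Data.Fin using (Fin; zero; suc; toℕ; fromℕ; inject₁)
open import Data.Fin.Properties using (toℕ-fromℕ; toℕ-inject₁)
open import Data.Fin.Relation.Unary.Top using (view; ‵fromℕ; ‵inject₁)
open import Data.Product using (_,_)
open import Function.Bundles using (_⇔_; mk⇔)
open import Relation.Binary.PropositionalEquality
  using (_≡_; refl; sym; trans; cong; subst)

slot : (w : ℕ) → ℤ → Fin w → ℤ
slot w k j = (k - + 1) * + w + + suc (toℕ j)

i-1≡j⇒i≡j+1 : ∀ {i j} → i - + 1 ≡ j → i ≡ j + + 1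
i-1≡j⇒i≡j+1 {i} refl = identity i
  where
  identity : ∀ i → i ≡ i - + 1 + + 1
  identity = solve-∀

slot-pred-block : ∀ w k (j : Fin w) → slot w k j - + w ≡ slot w (k - + 1) j
slot-pred-block w k j = identity k (+ w) (+ suc (toℕ j))
  where
  identity : ∀ k W J → (k - + 1) * W + J - W ≡ ((k - + 1) - + 1) * W + J
  identity = solve-∀

slot-suc-block : ∀ w k (j : Fin w) → slot w (k + + 1) j - + w ≡ slot w k j
slot-suc-block w k j = identity k (+ w) (+ suc (toℕ j))
  where
  identity : ∀ k W J → ((k + + 1) - + 1) * W + J - W ≡ (k - + 1) * W + J
  identity = solve-∀

slot-suc-pred : ∀ m k (j : Fin m) →
  slot (suc m) k (suc j) - + 1 ≡ slot (suc m) k (inject₁ j)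
slot-suc-pred m k j rewrite toℕ-inject₁ j =
  identity ((k - + 1) * + suc m) (+ suc (toℕ j))
  where
  identity : ∀ A J → A + (+ 1 + J) - + 1 ≡ A + J
  identity = solve-∀

slot-inject₁-suc : ∀ m k (j : Fin m) →
  slot (suc m) k (inject₁ j) + + 1 ≡ slot (suc m) k (suc j)
slot-inject₁-suc m k j rewrite toℕ-inject₁ j =
  identity ((k - + 1) * + suc m) (+ suc (toℕ j))
  where
  identity : ∀ A J → A + J + + 1 ≡ A + (+ 1 + J)
  identity = solve-∀

slot-zero-pred : ∀ m k →
  slot (suc m) k zero - + 1 ≡ slot (suc m) (k - + 1) (fromℕ m)
slot-zero-pred m k rewrite toℕ-fromℕ m = identity k (+ suc m)
  where
  identity : ∀ k L → (k - + 1) * L + + 1 - + 1 ≡ ((k - + 1) - + 1) * L + L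
  identity = solve-∀

slot-fromℕ-suc : ∀ m k →
  slot (suc m) k (fromℕ m) + + 1 ≡ slot (suc m) (k + + 1) zero
slot-fromℕ-suc m k rewrite toℕ-fromℕ m = identity k (+ suc m)
  where
  identity : ∀ k L → (k - + 1) * L + L + + 1 ≡ ((k + + 1) - + 1) * L + + 1
  identity = solve-∀

star-xiHat⇔pr-star : ∀ n m (b : Fin (suc m) → Col) (i : Fin n) (y : ℤ) →
  star n (suc m) (xiHat n b) i y ⇔ pr (star n (suc m) b) i y
star-xiHat⇔pr-star n m b i y = mk⇔ to from
  where
  to : star n (suc m) (xiHat n b) i y → pr (star n (suc m) b) i y
  to (k , zero , y≡ , cell) =
    k - + 1 , fromℕ m , trans (cong (_- + 1) y≡) (slot-zero-pred m k) ,
    subst (b (fromℕ m)) (slot-pred-block n k i) cell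
  to (k , suc j , y≡ , cell) =
    k , inject₁ j , trans (cong (_- + 1) y≡) (slot-suc-pred m k j) , cell

  from : pr (star n (suc m) b) i y → star n (suc m) (xiHat n b) i y
  from (k , j , y-1≡ , cell) with view j
  ... | ‵fromℕ =
    k + + 1 , zero , trans (i-1≡j⇒i≡j+1 y-1≡) (slot-fromℕ-suc m k) ,
    subst (b (fromℕ m)) (sym (slot-suc-block n k i)) cell
  ... | ‵inject₁ j′ =
    k , suc j′ , trans (i-1≡j⇒i≡j+1 y-1≡) (slot-inject₁-suc m k j′) , cell

proposition3p23 : (n ℓ : ℕ) → 2 ≤ n → 2 ≤ ℓ → (s : ℤ) → (b : Fin ℓ → Col) →
    InFhat ℓ s b →
    (i : Fin n) (y : ℤ) → star n ℓ (xiHat n b) i y ⇔ pr (star n ℓ b) i y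
proposition3p23 n (suc m) _ (s≤s _) _ b _ = star-xiHat⇔pr-star n m b
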